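{- For every area sequence $w$ of size $n$, $\operatorname{bounce}(w) = \operatorname{area}(\psi(w))$.
   Context: An area sequence of size $n$ is a word $w = w_1 \dots w_n$ of nonnegative integers with $w_1 = 0$ and $0 \le w_{i+1} \le w_i + 1$ for $1 \le i < n$; the empty word $\varepsilon$ is the area sequence of size $0$. Its area is $\operatorname{area}(w) = \sum_i w_i$. Bounce sequence: $b_1 = 0$ and for $i \ge 2$, $b_i = b_{i-1}+1$ if $b_{i-1}+1 \le w_i$, and $b_i = 0$ otherwise. The bounce statistic is $\operatorname{bounce}(w) = \sum_{i > 1,\, b_i = 0} (n - i + 1)$. Insertion: $\operatorname{ins}_0(w) := 0 w_1 \dots w_n$, and for $1 \le i \le n$, $\operatorname{ins}_i(w) := w_1 \dots w_i (w_i+1) w_{i+1} \dots w_n$. For a nonempty area sequence $v$ with maximum value $m$: $\mathrm{Maxb}(v) = \{ i : v_i = m\}$; $\mathrm{Maxa}(v)$ is the set of positions $i$ with $v_i = m-1$ and $v_j < m$ for all $j > i$; $i_0(v)$ is the position of the leftmost letter of the rightmost block of consecutive letters equal to $m$. The admissible insertion positions of $v$ are $\mathrm{Maxb}(v) \cup \mathrm{Maxa}(v) \cup \{i_0(v) - 1\}$, in admissible order: elements of $\mathrm{Maxb}(v)$ decreasing, then elements of $\mathrm{Maxa}(v)$ decreasing, then $i_0(v)-1$. For the empty word, the only admissible insertion position is $0$. The map $\psi$: $\psi(\varepsilon) = \varepsilon$, and for $w = ua$ with last letter $a$, $\psi(w) = \operatorname{ins}_{c_a}(\psi(u))$ where $c_0,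 \dots, c_k$ are the admissible insertion positions of $\psi(u)$ in admissible order. -}

module Defs where

open import Data.Nat using (ℕ; zero; suc; _+_; _∸_; _≤_; _⊔_; _≡ᵇ_; _<ᵇ_; _≤ᵇ_)
open import Data.Bool using (Bool; true; false; if_then_else_; _∧_; _∨_; not)
open import Data.List using (List; []; _∷_; _++_; map; filter; foldl; foldr; reverse; take; drop; length; upTo; last)
open import Data.Nat.ListAction using (sum)
open import Data.Maybe using (Maybe; just; nothing)
open import Data.Unit using (⊤)
open import Data.Product using (_×_)
open import Relation.Binary.PropositionalEquality using (_≡_)
open import Relation.Nullary.Decidable using (does)
open import Data.Bool.Properties using (T?)
open import Data.Bool using (T)

-- Words are lists of natural numbers; positions are 1-indexed.

Steps : ℕ → List ℕ → Set
Steps prev []       = ⊤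
Steps prev (x ∷ xs) = (x ≤ suc prev) × Steps x xs

IsAreaSeq : List ℕ → Set
IsAreaSeq []       = ⊤
IsAreaSeq (x ∷ xs) = (x ≡ 0) × Steps x xs

area : List ℕ → ℕ
area = sum

-- 1-indexed lookup (value 0 outside 1..n; never used out of range)
nth : List ℕ → ℕ → ℕ
nth []       _             = 0
nth (x ∷ xs) zero          = 0
nth (x ∷ xs) (suc zero)    = x
nth (x ∷ xs) (suc (suc i)) = nth xs (suc i)

positions : List ℕ → List ℕ
positions w = map suc (upTo (length w))

bounceTail : ℕ → List ℕ → List ℕ
bounceTail prev []       = []
bounceTail prev (x ∷ xs) =
  let b = if suc prev ≤ᵇ x then suc prev else 0 in b ∷ bounceTail b xs

bounceSeq : List ℕ → List ℕ
bounceSeq []       = []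
bounceSeq (x ∷ xs) = 0 ∷ bounceTail 0 xs

bounce : List ℕ → ℕ
bounce w =
  sum (map (λ i → suc (length w) ∸ i)
           (filter (λ i → T? ((1 <ᵇ i) ∧ (nth (bounceSeq w) i ≡ᵇ 0)))
                   (positions w)))

ins : ℕ → List ℕ → List ℕ
ins zero    w = 0 ∷ w
ins (suc i) w = take (suc i) w ++ (suc (nth w (suc i)) ∷ drop (suc i) w)

maxVal : List ℕ → ℕ
maxVal = foldr _⊔_ 0

maxb : List ℕ → List ℕ
maxb v = filter (λ i → T? (nth v i ≡ᵇ maxVal v)) (reverse (positions v))

_⇒ᵇ_ : Bool → Bool → Bool
a ⇒ᵇ b = not a ∨ b

allAfterBelow : List ℕ → ℕ → Bool
allAfterBelow v i =
  foldr _∧_ true (map (λ j → (i <ᵇ j) ⇒ᵇ (nth v j <ᵇ maxVal v)) (positions v))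

maxa : List ℕ → List ℕ
maxa v = filter (λ i → T? ((suc (nth v i) ≡ᵇ maxVal v) ∧ allAfterBelow v i))
                (reverse (positions v))

-- i₀(v): leftmost position of the rightmost block of letters equal to m,
-- i.e. the largest i with v_i = m and (i = 1 or v_{i-1} ≠ m)
blockStarts : List ℕ → List ℕ
blockStarts v =
  filter (λ i → T? ((nth v i ≡ᵇ maxVal v) ∧ ((i ≡ᵇ 1) ∨ not (nth v (i ∸ 1) ≡ᵇ maxVal v))))
         (positions v)

i₀ : List ℕ → ℕ
i₀ v with last (blockStarts v)
... | just i  = i
... | nothing = 0   -- unreachable for nonempty v

admissible : List ℕ → List ℕ
admissible []          = 0 ∷ []
admissible v@(_ ∷ _)   = maxb v ++ maxa v ++ (i₀ v ∸ 1 ∷ [])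

-- c_a : the a-th (0-indexed) admissible position
-- (default 0 if out of range; this never happens for area sequences)
index : List ℕ → ℕ → ℕ
index []       _       = 0
index (c ∷ cs) zero    = c
index (c ∷ cs) (suc a) = index cs a

ψstep : List ℕ → ℕ → List ℕ
ψstep v a = ins (index (admissible v) a) v

ψ : List ℕ → List ℕ
ψ w = foldl ψstep [] w

module Submission where

-- Reading w letter by letter, ψ follows the bounce path of w. After a prefix u, let z be the number of resets
-- (positions i > 1 with b_i = 0), b the current bounce letter and l the last letter of u. Then ψ(u) has maximum z,
-- attained b + 1 times, and Maxa(ψ u) has l - b elements; so the next letter a ≤ l + 1 always picks one of the
-- l + 2 admissible positions. A letter a ≤ b is a reset and inserts z + 1 after a maximal letter; any other letter
-- raises the bounce letter by one and inserts z, after a letter of Maxa or in front of the rightmost block of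
-- maxima. Hence area(ψ w) sums the running number of resets over all positions, which is the bounce statistic
-- counted reset by reset.

open import Defs
open import Data.Bool using (Bool; true; false; if_then_else_; _∧_; _∨_; not; T)
open import Data.Bool.Properties using (T?; T-≡; ∧-zeroʳ; ∧-identityʳ)
open import Data.Bool.ListAction using (and; all)
open import Data.List using (List; []; _∷_; _++_; map; filterᵇ; foldl; reverse; length; upTo; last; replicate)
open import Data.List.Properties
  using ( map-∘; map-cong; map-applyUpTo; unfold-reverse; reverse-map; filter-++; filter-≐; ++-assoc; ++-identityʳ
        ; length-++; length-map; last-map)
open import Data.Nat
  using (ℕ; zero; suc; _+_; _*_; _∸_; _≤_; _<_; _≡ᵇ_; _<ᵇ_; _≤ᵇ_; _≟_; _≤?_; _<?_; z≤n; s≤s; z<s)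
open import Data.Nat.Properties
open import Data.Nat.ListAction using (sum)
open import Data.Nat.Solver using (module +-*-Solver)
open import Data.Product using (_×_; _,_; ∃-syntax)
open import Data.Sum using (inj₁; inj₂)
open import Data.List.Relation.Unary.All as All using (All; []; _∷_)
open import Data.List.Relation.Unary.All.Properties using (all⁺; all⁻; ++⁻ʳ; replicate⁺)
open import Relation.Nullary using (yes; no; contradiction)
open import Relation.Nullary.Decidable using (dec-true; dec-false)
import Data.Maybe as Maybe
open import Data.Maybe using (just)
open import Function using (_∘_; Equivalence)
open import Relation.Binary.PropositionalEquality
open ≡-Reasoning

open +-*-Solver using (solve; _:+_; _:*_; _:=_; con)

filterᵇ-∷ : ∀ {A : Set} (f : A → Bool) y L →
            filterᵇ f (y ∷ L) ≡ (if f y then y ∷ [] else []) ++ filterᵇ f L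
filterᵇ-∷ f y L with f y
... | true  = refl
... | false = refl

filterᵇ-map : ∀ {A B : Set} (f : B → Bool) (h : A → B) L →
              filterᵇ f (map h L) ≡ map h (filterᵇ (f ∘ h) L)
filterᵇ-map f h []      = refl
filterᵇ-map f h (x ∷ L) with f (h x)
... | true  = cong (h x ∷_) (filterᵇ-map f h L)
... | false = filterᵇ-map f h L

filterᵇ-cong : ∀ {A : Set} {f g : A → Bool} → (∀ x → f x ≡ g x) → ∀ L → filterᵇ f L ≡ filterᵇ g L
filterᵇ-cong {f = f} {g} f≗g =
  filter-≐ (T? ∘ f) (T? ∘ g) ((λ {x} → subst T (f≗g x)) , (λ {x} → subst T (sym (f≗g x))))

all-map : ∀ {A B : Set} (f : B → Bool) (h : A → B) L → all f (map h L) ≡ all (f ∘ h) L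
all-map f h L = cong and (sym (map-∘ L))

all-cong : ∀ {A : Set} {f g : A → Bool} → (∀ x → f x ≡ g x) → ∀ L → all f L ≡ all g L
all-cong f≗g L = cong and (map-cong f≗g L)

positions-∷ : ∀ (x : ℕ) v → positions (x ∷ v) ≡ 1 ∷ map suc (positions v)
positions-∷ x v = cong (λ U → map suc (0 ∷ U)) (sym (map-applyUpTo (λ i → i) suc (length v)))

-- f read on the positions of x ∷ v agrees with g read on those of v
ShiftOf : (ℕ → Bool) → (ℕ → Bool) → Set
ShiftOf f g = ∀ i → f (suc (suc i)) ≡ g (suc i)

filterᵇ-shift : ∀ {f g} → ShiftOf f g → ∀ U →
                filterᵇ f (map suc (map suc U)) ≡ map suc (filterᵇ g (map suc U))
filterᵇ-shift {f} {g} f≈g U = begin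
  filterᵇ f (map suc (map suc U))                  ≡⟨ filterᵇ-map f suc (map suc U) ⟩
  map suc (filterᵇ (f ∘ suc) (map suc U))          ≡⟨ cong (map suc) (filterᵇ-map (f ∘ suc) suc U) ⟩
  map suc (map suc (filterᵇ (f ∘ suc ∘ suc) U))    ≡⟨ cong (map suc ∘ map suc) (filterᵇ-cong f≈g U) ⟩
  map suc (map suc (filterᵇ (g ∘ suc) U))          ≡⟨ cong (map suc) (filterᵇ-map g suc U) ⟨
  map suc (filterᵇ g (map suc U))                  ∎

filterᵇ-positions-∷ : ∀ f g → ShiftOf f g → ∀ x v →
  filterᵇ f (positions (x ∷ v)) ≡ (if f 1 then 1 ∷ [] else []) ++ map suc (filterᵇ g (positions v))
filterᵇ-positions-∷ f g f≈g x v = begin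
  filterᵇ f (positions (x ∷ v))
    ≡⟨ cong (filterᵇ f) (positions-∷ x v) ⟩
  filterᵇ f (1 ∷ map suc (positions v))
    ≡⟨ filterᵇ-∷ f 1 _ ⟩
  (if f 1 then 1 ∷ [] else []) ++ filterᵇ f (map suc (positions v))
    ≡⟨ cong (_ ++_) (filterᵇ-shift f≈g (upTo (length v))) ⟩
  (if f 1 then 1 ∷ [] else []) ++ map suc (filterᵇ g (positions v)) ∎

filterᵇ-reverse-positions-∷ : ∀ f g → ShiftOf f g → ∀ x v →
  filterᵇ f (reverse (positions (x ∷ v)))
    ≡ map suc (filterᵇ g (reverse (positions v))) ++ (if f 1 then 1 ∷ [] else [])
filterᵇ-reverse-positions-∷ f g f≈g x v = begin
  filterᵇ f (reverse (positions (x ∷ v)))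
    ≡⟨ cong (filterᵇ f ∘ reverse) (positions-∷ x v) ⟩
  filterᵇ f (reverse (1 ∷ map suc (positions v)))
    ≡⟨ cong (filterᵇ f) (unfold-reverse 1 (map suc (positions v))) ⟩
  filterᵇ f (reverse (map suc (positions v)) ++ 1 ∷ [])
    ≡⟨ cong (λ L → filterᵇ f (L ++ 1 ∷ []))
            (trans (cong (map suc) (reverse-map suc U)) (reverse-map suc (positions v))) ⟨
  filterᵇ f (map suc (map suc (reverse U)) ++ 1 ∷ [])
    ≡⟨ filter-++ (T? ∘ f) (map suc (map suc (reverse U))) (1 ∷ []) ⟩
  filterᵇ f (map suc (map suc (reverse U))) ++ filterᵇ f (1 ∷ [])
    ≡⟨ cong₂ _++_ (filterᵇ-shift f≈g (reverse U)) (trans (filterᵇ-∷ f 1 []) (++-identityʳ _)) ⟩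
  map suc (filterᵇ g (map suc (reverse U))) ++ (if f 1 then 1 ∷ [] else [])
    ≡⟨ cong (λ L → map suc (filterᵇ g L) ++ _) (reverse-map suc U) ⟩
  map suc (filterᵇ g (reverse (positions v))) ++ (if f 1 then 1 ∷ [] else []) ∎
  where U = upTo (length v)

all-positions-∷ : ∀ f g → ShiftOf f g → ∀ x v → all f (positions (x ∷ v)) ≡ f 1 ∧ all g (positions v)
all-positions-∷ f g f≈g x v = begin
  all f (positions (x ∷ v))           ≡⟨ cong (all f) (positions-∷ x v) ⟩
  f 1 ∧ all f (map suc (map suc U))   ≡⟨ cong (f 1 ∧_) (all-map f suc (map suc U)) ⟩
  f 1 ∧ all (f ∘ suc) (map suc U)     ≡⟨ cong (f 1 ∧_) (all-map (f ∘ suc) suc U) ⟩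
  f 1 ∧ all (f ∘ suc ∘ suc) U         ≡⟨ cong (f 1 ∧_) (all-cong f≈g U) ⟩
  f 1 ∧ all (g ∘ suc) U               ≡⟨ cong (f 1 ∧_) (all-map g suc U) ⟨
  f 1 ∧ all g (positions v)           ∎
  where U = upTo (length v)

-- The bounce statistic as a running sum

-- Reading xs from bounce letter b after z resets, add up after each letter the number of resets so far.
resetSum : ℕ → ℕ → List ℕ → ℕ
resetSum b z []       = 0
resetSum b z (x ∷ xs) = if suc b ≤ᵇ x then z + resetSum (suc b) z xs else suc z + resetSum 0 (suc z) xs

zeroWeight : List ℕ → ℕ
zeroWeight []      = 0
zeroWeight (t ∷ T) = (if t ≡ᵇ 0 then suc (length T) else 0) + zeroWeight T

length-bounceTail : ∀ b xs → length (bounceTail b xs) ≡ length xs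
length-bounceTail b []       = refl
length-bounceTail b (x ∷ xs) = cong suc (length-bounceTail _ xs)

resetSum-zeroWeight : ∀ b z xs → resetSum b z xs ≡ z * length xs + zeroWeight (bounceTail b xs)
resetSum-zeroWeight b z [] = sym (trans (+-identityʳ (z * 0)) (*-zeroʳ z))
resetSum-zeroWeight b z (x ∷ xs) with suc b ≤ᵇ x
... | true  rewrite resetSum-zeroWeight (suc b) z xs =
  trans (sym (+-assoc z (z * length xs) w)) (cong (_+ w) (sym (*-suc z (length xs))))
  where w = zeroWeight (bounceTail (suc b) xs)
... | false rewrite resetSum-zeroWeight 0 (suc z) xs | length-bounceTail 0 xs =
  solve 3 (λ z n w → (con 1 :+ z) :+ ((con 1 :+ z) :* n :+ w) := z :* (con 1 :+ n) :+ ((con 1 :+ n) :+ w))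
        refl z (length xs) (zeroWeight (bounceTail 0 xs))

zeroWeight-positions : ∀ T →
  sum (map (suc (length T) ∸_) (filterᵇ (λ i → nth T i ≡ᵇ 0) (positions T))) ≡ zeroWeight T
zeroWeight-positions []      = refl
zeroWeight-positions (t ∷ T) = begin
  sum (map (suc (suc n) ∸_) (filterᵇ (λ i → nth (t ∷ T) i ≡ᵇ 0) (positions (t ∷ T))))
    ≡⟨ cong (sum ∘ map (suc (suc n) ∸_))
            (filterᵇ-positions-∷ (λ i → nth (t ∷ T) i ≡ᵇ 0) (λ i → nth T i ≡ᵇ 0) (λ _ → refl) t T) ⟩
  sum (map (suc (suc n) ∸_) ((if t ≡ᵇ 0 then 1 ∷ [] else []) ++ map suc L))
    ≡⟨ split (t ≡ᵇ 0) ⟩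
  (if t ≡ᵇ 0 then suc n else 0) + sum (map (suc n ∸_) L)
    ≡⟨ cong ((if t ≡ᵇ 0 then suc n else 0) +_) (zeroWeight-positions T) ⟩
  zeroWeight (t ∷ T) ∎
  where
  n = length T
  L = filterᵇ (λ i → nth T i ≡ᵇ 0) (positions T)
  shifted : sum (map (suc (suc n) ∸_) (map suc L)) ≡ sum (map (suc n ∸_) L)
  shifted = cong sum (sym (map-∘ L))
  split : ∀ c → sum (map (suc (suc n) ∸_) ((if c then 1 ∷ [] else []) ++ map suc L))
              ≡ (if c then suc n else 0) + sum (map (suc n ∸_) L)
  split true  = cong (suc n +_) shifted
  split false = shifted

bounce-resetSum : ∀ x xs → bounce (x ∷ xs) ≡ resetSum 0 0 xs
bounce-resetSum x xs = begin
  bounce (x ∷ xs)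
    ≡⟨ cong (sum ∘ map (suc (suc n) ∸_)) (filterᵇ-positions-∷ afterFirst isZero (λ _ → refl) x xs) ⟩
  sum (map (suc (suc n) ∸_) (map suc (filterᵇ isZero (positions xs))))
    ≡⟨ cong sum (sym (map-∘ (filterᵇ isZero (positions xs)))) ⟩
  sum (map (suc n ∸_) (filterᵇ isZero (positions xs)))
    ≡⟨ cong (λ k → sum (map (suc k ∸_) (filterᵇ isZero (map suc (upTo k))))) (sym (length-bounceTail 0 xs)) ⟩
  sum (map (suc (length bs) ∸_) (filterᵇ isZero (positions bs)))
    ≡⟨ zeroWeight-positions bs ⟩
  zeroWeight bs
    ≡⟨ resetSum-zeroWeight 0 0 xs ⟨
  resetSum 0 0 xs ∎
  where
  n = length xs
  bs = bounceTail 0 xs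
  isZero afterFirst : ℕ → Bool
  isZero i = nth bs i ≡ᵇ 0
  afterFirst i = (1 <ᵇ i) ∧ (nth (0 ∷ bs) i ≡ᵇ 0)

-- Maxb, Maxa and the block starts for a prescribed maximum M, by recursion on the word

maxbFor : ℕ → List ℕ → List ℕ
maxbFor M []      = []
maxbFor M (x ∷ v) = map suc (maxbFor M v) ++ (if x ≡ᵇ M then 1 ∷ [] else [])

maxaFor : ℕ → List ℕ → List ℕ
maxaFor M []      = []
maxaFor M (x ∷ v) = map suc (maxaFor M v) ++ (if (suc x ≡ᵇ M) ∧ all (_<ᵇ M) v then 1 ∷ [] else [])

-- the flag records whether the letter preceding the word equals M
blockStartsFor : ℕ → Bool → List ℕ → List ℕ
blockStartsFor M prev []      = []
blockStartsFor M prev (y ∷ v) =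
  (if (y ≡ᵇ M) ∧ not prev then 1 ∷ [] else []) ++ map suc (blockStartsFor M (y ≡ᵇ M) v)

maxbFor-spec : ∀ M v → filterᵇ (λ i → nth v i ≡ᵇ M) (reverse (positions v)) ≡ maxbFor M v
maxbFor-spec M []      = refl
maxbFor-spec M (x ∷ v) =
  trans (filterᵇ-reverse-positions-∷ _ (λ i → nth v i ≡ᵇ M) (λ _ → refl) x v)
        (cong (λ L → map suc L ++ _) (maxbFor-spec M v))

allAfterBelowFor : ℕ → List ℕ → ℕ → Bool
allAfterBelowFor M v i = all (λ j → (i <ᵇ j) ⇒ᵇ (nth v j <ᵇ M)) (positions v)

map-nth-positions : ∀ v → map (nth v) (positions v) ≡ v
map-nth-positions []      = refl
map-nth-positions (x ∷ v) = trans (cong (map (nth (x ∷ v))) (positions-∷ x v)) (cong (x ∷_) (begin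
  map (nth (x ∷ v)) (map suc (map suc U))  ≡⟨ map-∘ (map suc U) ⟨
  map (nth (x ∷ v) ∘ suc) (map suc U)      ≡⟨ map-∘ U ⟨
  map (nth v ∘ suc) U                      ≡⟨ map-∘ U ⟩
  map (nth v) (positions v)                ≡⟨ map-nth-positions v ⟩
  v                                        ∎))
  where U = upTo (length v)

allAfterBelowFor-1 : ∀ M x v → allAfterBelowFor M (x ∷ v) 1 ≡ all (_<ᵇ M) v
allAfterBelowFor-1 M x v = begin
  allAfterBelowFor M (x ∷ v) 1
    ≡⟨ all-positions-∷ (λ j → (1 <ᵇ j) ⇒ᵇ (nth (x ∷ v) j <ᵇ M)) ((_<ᵇ M) ∘ nth v) (λ _ → refl) x v ⟩
  all ((_<ᵇ M) ∘ nth v) (positions v)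
    ≡⟨ all-map (_<ᵇ M) (nth v) (positions v) ⟨
  all (_<ᵇ M) (map (nth v) (positions v))
    ≡⟨ cong (all (_<ᵇ M)) (map-nth-positions v) ⟩
  all (_<ᵇ M) v ∎

allAfterBelowFor-suc : ∀ M x v i → allAfterBelowFor M (x ∷ v) (suc (suc i)) ≡ allAfterBelowFor M v (suc i)
allAfterBelowFor-suc M x v i =
  all-positions-∷ (λ j → (suc (suc i) <ᵇ j) ⇒ᵇ (nth (x ∷ v) j <ᵇ M)) (λ j → (suc i <ᵇ j) ⇒ᵇ (nth v j <ᵇ M))
                  (λ _ → refl) x v

maxaFor-spec : ∀ M v →
  filterᵇ (λ i → (suc (nth v i) ≡ᵇ M) ∧ allAfterBelowFor M v i) (reverse (positions v)) ≡ maxaFor M v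
maxaFor-spec M []      = refl
maxaFor-spec M (x ∷ v) =
  trans (filterᵇ-reverse-positions-∷ _ (λ i → (suc (nth v i) ≡ᵇ M) ∧ allAfterBelowFor M v i)
          (λ i → cong ((suc (nth v (suc i)) ≡ᵇ M) ∧_) (allAfterBelowFor-suc M x v i)) x v)
        (cong₂ (λ L c → map suc L ++ (if (suc x ≡ᵇ M) ∧ c then 1 ∷ [] else []))
               (maxaFor-spec M v) (allAfterBelowFor-1 M x v))

blockStartsFor-spec : ∀ M p v →
  filterᵇ (λ i → (nth v i ≡ᵇ M) ∧ not (nth (p ∷ v) i ≡ᵇ M)) (positions v) ≡ blockStartsFor M (p ≡ᵇ M) v
blockStartsFor-spec M p []      = refl
blockStartsFor-spec M p (y ∷ v) =
  trans (filterᵇ-positions-∷ (λ i → (nth (y ∷ v) i ≡ᵇ M) ∧ not (nth (p ∷ y ∷ v) i ≡ᵇ M))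
                              (λ i → (nth v i ≡ᵇ M) ∧ not (nth (y ∷ v) i ≡ᵇ M)) (λ _ → refl) y v)
        (cong (λ L → (if (y ≡ᵇ M) ∧ not (p ≡ᵇ M) then 1 ∷ [] else []) ++ map suc L) (blockStartsFor-spec M y v))

blockStarts-spec : ∀ M v →
  filterᵇ (λ i → (nth v i ≡ᵇ M) ∧ ((i ≡ᵇ 1) ∨ not (nth v (i ∸ 1) ≡ᵇ M))) (positions v)
    ≡ blockStartsFor M false v
blockStarts-spec M []      = refl
blockStarts-spec M (x ∷ v) =
  trans (filterᵇ-positions-∷ (λ i → (nth (x ∷ v) i ≡ᵇ M) ∧ ((i ≡ᵇ 1) ∨ not (nth (x ∷ v) (i ∸ 1) ≡ᵇ M)))
                              (λ i → (nth v i ≡ᵇ M) ∧ not (nth (x ∷ v) i ≡ᵇ M)) (λ _ → refl) x v)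
        (cong (λ L → (if (x ≡ᵇ M) ∧ true then 1 ∷ [] else []) ++ map suc L) (blockStartsFor-spec M x v))

occurrences : ℕ → List ℕ → ℕ
occurrences M []      = 0
occurrences M (x ∷ v) = if x ≡ᵇ M then suc (occurrences M v) else occurrences M v

≡ᵇ-true⇒≡ : ∀ {x M} → (x ≡ᵇ M) ≡ true → x ≡ M
≡ᵇ-true⇒≡ {x} {M} eq = ≡ᵇ⇒≡ x M (subst T (sym eq) _)

length-map-suc-++ : ∀ (L R : List ℕ) → length (map suc L ++ R) ≡ length R + length L
length-map-suc-++ L R =
  trans (length-++ (map suc L)) (trans (cong (_+ length R) (length-map suc L)) (+-comm (length L) (length R)))

length-maxbFor : ∀ M v → length (maxbFor M v) ≡ occurrences M v
length-maxbFor M []      = refl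
length-maxbFor M (x ∷ v) with x ≡ᵇ M
... | true  = trans (length-map-suc-++ (maxbFor M v) (1 ∷ [])) (cong suc (length-maxbFor M v))
... | false = trans (length-map-suc-++ (maxbFor M v) []) (length-maxbFor M v)

occurrences-below : ∀ {M} v → All (_< M) v → occurrences M v ≡ 0
occurrences-below []      []           = refl
occurrences-below {M} (x ∷ v) (x<M ∷ v<M) rewrite dec-false (x ≟ M) (<⇒≢ x<M) = occurrences-below v v<M

occurrences-insert : ∀ M X p Z → occurrences M (X ++ p ∷ M ∷ Z) ≡ suc (occurrences M (X ++ p ∷ Z))
occurrences-insert M [] p Z with p ≡ᵇ M
... | true  rewrite dec-true (M ≟ M) refl = refl
... | false rewrite dec-true (M ≟ M) refl = refl
occurrences-insert M (x ∷ X) p Z with x ≡ᵇ M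
... | true  = cong suc (occurrences-insert M X p Z)
... | false = occurrences-insert M X p Z

occurrences-replicate : ∀ M n → occurrences M (replicate n M) ≡ n
occurrences-replicate M zero    = refl
occurrences-replicate M (suc n) rewrite dec-true (M ≟ M) refl = cong suc (occurrences-replicate M n)

index-++ˡ : ∀ (L R : List ℕ) {a} → a < length L → index (L ++ R) a ≡ index L a
index-++ˡ (c ∷ L) R {zero}  _         = refl
index-++ˡ (c ∷ L) R {suc a} (s≤s a<L) = index-++ˡ L R a<L

index-++ʳ : ∀ (L R : List ℕ) k → index (L ++ R) (length L + k) ≡ index R k
index-++ʳ []      R k = refl
index-++ʳ (c ∷ L) R k = index-++ʳ L R k

index-map-suc : ∀ (L : List ℕ) {a} → a < length L → index (map suc L) a ≡ suc (index L a)
index-map-suc (c ∷ L) {zero}  _         = refl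
index-map-suc (c ∷ L) {suc a} (s≤s a<L) = index-map-suc L a<L

index-last : ∀ (L : List ℕ) t → index (L ++ t ∷ []) (length L) ≡ t
index-last []      t = refl
index-last (c ∷ L) t = index-last L t

index-map-suc-++ : ∀ (L R : List ℕ) {a} → a < length L → index (map suc L ++ R) a ≡ suc (index L a)
index-map-suc-++ L R {a} a<L =
  trans (index-++ˡ (map suc L) R (subst (a <_) (sym (length-map suc L)) a<L)) (index-map-suc L a<L)

maxbFor-index : ∀ M v {a} → a < occurrences M v →
  ∃[ X ] ∃[ Z ] v ≡ X ++ M ∷ Z × index (maxbFor M v) a ≡ suc (length X) × occurrences M Z ≡ a
maxbFor-index M (x ∷ v) {a} a<occ with a <? occurrences M v
... | yes a<occ′ with maxbFor-index M v a<occ′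
...   | X , Z , refl , idx , occZ =
  x ∷ X , Z , refl ,
  trans (index-map-suc-++ (maxbFor M v) _ (subst (a <_) (sym (length-maxbFor M v)) a<occ′)) (cong suc idx) , occZ
maxbFor-index M (x ∷ v) {a} a<occ | no a≮occ with x ≡ᵇ M in x≡M
... | false = contradiction a<occ a≮occ
... | true with ≤-antisym (≤-pred a<occ) (≮⇒≥ a≮occ)
...   | refl =
  [] , v , cong (_∷ v) (≡ᵇ-true⇒≡ x≡M) ,
  trans (cong (index (map suc (maxbFor M v) ++ 1 ∷ []))
              (sym (trans (length-map suc (maxbFor M v)) (length-maxbFor M v))))
        (index-last (map suc (maxbFor M v)) 1) ,
  refl

all<ᵇ⇒All : ∀ {M} v → all (_<ᵇ M) v ≡ true → All (_< M) v
all<ᵇ⇒All {M} v eq = All.map (λ {x} → <ᵇ⇒< x M) (all⁺ (_<ᵇ M) v (Equivalence.from T-≡ eq))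

All⇒all<ᵇ : ∀ {M v} → All (_< M) v → all (_<ᵇ M) v ≡ true
All⇒all<ᵇ {M} v<M = Equivalence.to T-≡ (all⁻ (_<ᵇ M) (All.map <⇒<ᵇ v<M))

maxaFor-index : ∀ M v {d} → d < length (maxaFor M v) →
  ∃[ X ] ∃[ p ] ∃[ Z ] v ≡ X ++ p ∷ Z × suc p ≡ M × All (_< M) Z ×
                       index (maxaFor M v) d ≡ suc (length X) × length (maxaFor M Z) ≡ d
maxaFor-index M (x ∷ v) {d} d<len with d <? length (maxaFor M v)
... | yes d<len′ with maxaFor-index M v d<len′
...   | X , p , Z , refl , p+1≡M , Z<M , idx , lenZ =
  x ∷ X , p , Z , refl , p+1≡M , Z<M , trans (index-map-suc-++ (maxaFor M v) _ d<len′) (cong suc idx) , lenZ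
maxaFor-index M (x ∷ v) {d} d<len | no d≮len with suc x ≡ᵇ M in x+1≡M | all (_<ᵇ M) v in v<M
... | false | _     = contradiction (subst (d <_) (length-map-suc-++ (maxaFor M v) []) d<len) d≮len
... | true  | false = contradiction (subst (d <_) (length-map-suc-++ (maxaFor M v) []) d<len) d≮len
... | true  | true with ≤-antisym (≤-pred (subst (d <_) (length-map-suc-++ (maxaFor M v) (1 ∷ [])) d<len)) (≮⇒≥ d≮len)
...   | refl =
  [] , x , v , refl , ≡ᵇ-true⇒≡ x+1≡M , all<ᵇ⇒All v v<M ,
  trans (cong (index (map suc (maxaFor M v) ++ 1 ∷ [])) (sym (length-map suc (maxaFor M v))))
        (index-last (map suc (maxaFor M v)) 1) ,
  refl

all<ᵇ-peak : ∀ M A B → all (_<ᵇ M) (A ++ M ∷ B) ≡ false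
all<ᵇ-peak M []      B rewrite dec-false (M <? M) (<-irrefl refl) = refl
all<ᵇ-peak M (x ∷ A) B rewrite all<ᵇ-peak M A B = ∧-zeroʳ (x <ᵇ M)

length-maxaFor-peak : ∀ M A B → length (maxaFor M (A ++ M ∷ B)) ≡ length (maxaFor M B)
length-maxaFor-peak M []      B rewrite dec-false (suc M ≟ M) 1+n≢n = length-map-suc-++ (maxaFor M B) []
length-maxaFor-peak M (x ∷ A) B rewrite all<ᵇ-peak M A B | ∧-zeroʳ (suc x ≡ᵇ M) =
  trans (length-map-suc-++ (maxaFor M (A ++ M ∷ B)) []) (length-maxaFor-peak M A B)

length-maxaFor-block : ∀ M X p B → length (maxaFor M (X ++ p ∷ M ∷ B)) ≡ length (maxaFor M B)
length-maxaFor-block M X p B =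
  trans (cong (length ∘ maxaFor M) (sym (++-assoc X (p ∷ []) (M ∷ B)))) (length-maxaFor-peak M (X ++ p ∷ []) B)

length-maxaFor-below : ∀ m Z → All (_< suc m) Z → length (maxaFor (suc m) Z) ≡ occurrences m Z
length-maxaFor-below m []      []           = refl
length-maxaFor-below m (x ∷ Z) (_ ∷ Z<m+1) rewrite All⇒all<ᵇ Z<m+1 | ∧-identityʳ (x ≡ᵇ m) with x ≡ᵇ m
... | true  = trans (length-map-suc-++ (maxaFor (suc m) Z) (1 ∷ [])) (cong suc (length-maxaFor-below m Z Z<m+1))
... | false = trans (length-map-suc-++ (maxaFor (suc m) Z) []) (length-maxaFor-below m Z Z<m+1)

maxaFor-zero : ∀ v → maxaFor 0 v ≡ []
maxaFor-zero []      = refl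
maxaFor-zero (x ∷ v) rewrite maxaFor-zero v = refl

blockStartsFor-below : ∀ M prev Z → All (_< M) Z → blockStartsFor M prev Z ≡ []
blockStartsFor-below M prev []      []           = refl
blockStartsFor-below M prev (y ∷ Z) (y<M ∷ Z<M)
  rewrite dec-false (y ≟ M) (<⇒≢ y<M) | blockStartsFor-below M false Z Z<M = refl

blockStartsFor-inBlock : ∀ M j Z → All (_< M) Z → blockStartsFor M true (replicate j M ++ Z) ≡ []
blockStartsFor-inBlock M zero    Z Z<M = blockStartsFor-below M true Z Z<M
blockStartsFor-inBlock M (suc j) Z Z<M rewrite dec-true (M ≟ M) refl | blockStartsFor-inBlock M j Z Z<M = refl

last-++ : ∀ {A : Set} (L R : List A) {t} → last R ≡ just t → last (L ++ R) ≡ just t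
last-++ []          R       eq = eq
last-++ (x ∷ [])    (y ∷ R) eq = eq
last-++ (x ∷ z ∷ L) (y ∷ R) eq = last-++ (z ∷ L) (y ∷ R) eq

blockStartsFor-last : ∀ M prev X p j Z → suc p ≡ M → All (_< M) Z →
  last (blockStartsFor M prev (X ++ p ∷ M ∷ replicate j M ++ Z)) ≡ just (suc (suc (length X)))
blockStartsFor-last M prev [] p j Z refl Z<M
  rewrite dec-false (p ≟ suc p) (1+n≢n ∘ sym) | dec-true (suc p ≟ suc p) refl
        | blockStartsFor-inBlock (suc p) j Z Z<M = refl
blockStartsFor-last M prev (x ∷ X) p j Z p+1≡M Z<M =
  last-++ (if (x ≡ᵇ M) ∧ not prev then 1 ∷ [] else []) _
          (trans (last-map suc (blockStartsFor M (x ≡ᵇ M) (X ++ p ∷ M ∷ replicate j M ++ Z)))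
                 (cong (Maybe.map suc) (blockStartsFor-last M (x ≡ᵇ M) X p j Z p+1≡M Z<M)))

i₀-blockStartsFor : ∀ {M t} v → maxVal v ≡ M → last (blockStartsFor M false v) ≡ just t → i₀ v ≡ t
i₀-blockStartsFor v refl eq with last (blockStarts v) | trans (cong last (blockStarts-spec (maxVal v) v)) eq
... | just t | refl = refl

-- Admissible positions of a word whose maximum is known

maxVal-≤ : ∀ {m} v → All (_≤ m) v → maxVal v ≤ m
maxVal-≤ []      []            = z≤n
maxVal-≤ (x ∷ v) (x≤m ∷ v≤m) = ⊔-lub x≤m (maxVal-≤ v v≤m)

maxVal-≥ : ∀ m X Z → m ≤ maxVal (X ++ m ∷ Z)
maxVal-≥ m []      Z = m≤m⊔n m (maxVal Z)
maxVal-≥ m (x ∷ X) Z = ≤-trans (maxVal-≥ m X Z) (m≤n⊔m x (maxVal (X ++ m ∷ Z)))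

record Peak (m b : ℕ) (v : List ℕ) : Set where
  field
    bounded : All (_≤ m) v
    count   : occurrences m v ≡ suc b

open Peak using (bounded; count)

maxVal-peak : ∀ {m b v} → Peak m b v → maxVal v ≡ m
maxVal-peak {m} {v = v} pk with maxbFor-index m v (subst (0 <_) (sym (count pk)) z<s)
... | X , Z , refl , _ = ≤-antisym (maxVal-≤ v (bounded pk)) (maxVal-≥ m X Z)

admissible-peak : ∀ {m b v} → Peak m b v → admissible v ≡ maxbFor m v ++ maxaFor m v ++ (i₀ v ∸ 1 ∷ [])
admissible-peak {v = []}        pk with count pk
... | ()
admissible-peak {m} {v = x ∷ v} pk =
  cong₂ (λ B A → B ++ A ++ (i₀ (x ∷ v) ∸ 1 ∷ []))
        (trans (maxbFor-spec _ (x ∷ v)) (cong (λ M → maxbFor M (x ∷ v)) (maxVal-peak pk)))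
        (trans (maxaFor-spec _ (x ∷ v)) (cong (λ M → maxaFor M (x ∷ v)) (maxVal-peak pk)))

length-maxbFor-peak : ∀ {m b v} → Peak m b v → length (maxbFor m v) ≡ suc b
length-maxbFor-peak {m} {v = v} pk = trans (length-maxbFor m v) (count pk)

index-admissible-maxb : ∀ {m b v a} → Peak m b v → a ≤ b → index (admissible v) a ≡ index (maxbFor m v) a
index-admissible-maxb {m} {v = v} pk a≤b =
  trans (cong (λ L → index L _) (admissible-peak pk))
        (index-++ˡ (maxbFor m v) _ (subst (_ <_) (sym (length-maxbFor-peak pk)) (s≤s a≤b)))

index-admissible-maxa : ∀ {m b v d} → Peak m b v → d < length (maxaFor m v) →
                        index (admissible v) (suc b + d) ≡ index (maxaFor m v) d
index-admissible-maxa {m} {b} {v} {d} pk d<len = begin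
  index (admissible v) (suc b + d)
    ≡⟨ cong₂ (λ L k → index L (k + d)) (admissible-peak pk) (sym (length-maxbFor-peak pk)) ⟩
  index (maxbFor m v ++ maxaFor m v ++ (i₀ v ∸ 1 ∷ [])) (length (maxbFor m v) + d)
    ≡⟨ index-++ʳ (maxbFor m v) _ d ⟩
  index (maxaFor m v ++ (i₀ v ∸ 1 ∷ [])) d
    ≡⟨ index-++ˡ (maxaFor m v) _ d<len ⟩
  index (maxaFor m v) d ∎

index-admissible-i₀ : ∀ {m b v} → Peak m b v → index (admissible v) (suc b + length (maxaFor m v)) ≡ i₀ v ∸ 1
index-admissible-i₀ {m} {b} {v} pk = begin
  index (admissible v) (suc b + length (maxaFor m v))
    ≡⟨ cong₂ (λ L k → index L (k + length (maxaFor m v))) (admissible-peak pk) (sym (length-maxbFor-peak pk)) ⟩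
  index (maxbFor m v ++ maxaFor m v ++ (i₀ v ∸ 1 ∷ [])) (length (maxbFor m v) + length (maxaFor m v))
    ≡⟨ index-++ʳ (maxbFor m v) _ _ ⟩
  index (maxaFor m v ++ (i₀ v ∸ 1 ∷ [])) (length (maxaFor m v))
    ≡⟨ index-last (maxaFor m v) _ ⟩
  i₀ v ∸ 1 ∎

ins-after : ∀ X p Z → ins (suc (length X)) (X ++ p ∷ Z) ≡ X ++ p ∷ suc p ∷ Z
ins-after []      p Z = refl
ins-after (x ∷ X) p Z = cong (x ∷_) (ins-after X p Z)

area-insert : ∀ X p y Z → area (X ++ p ∷ y ∷ Z) ≡ area (X ++ p ∷ Z) + y
area-insert []      p y Z = trans (cong (p +_) (+-comm y (area Z))) (sym (+-assoc p (area Z) y))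
area-insert (x ∷ X) p y Z = trans (cong (x +_) (area-insert X p y Z)) (sym (+-assoc x _ y))

All-insert : ∀ {P : ℕ → Set} X p {y} Z → All P (X ++ p ∷ Z) → P y → All P (X ++ p ∷ y ∷ Z)
All-insert []      p Z (Pp ∷ PZ) Py = Pp ∷ Py ∷ PZ
All-insert (x ∷ X) p Z (Px ∷ PX) Py = Px ∷ All-insert X p Z PX Py

ψstep-after : ∀ {v a} X p Z → v ≡ X ++ p ∷ Z → index (admissible v) a ≡ suc (length X) →
              ψstep v a ≡ X ++ p ∷ suc p ∷ Z
ψstep-after X p Z refl idx = trans (cong (λ c → ins c (X ++ p ∷ Z)) idx) (ins-after X p Z)

peak-insert : ∀ {m b} X p Z → Peak m b (X ++ p ∷ Z) → Peak m (suc b) (X ++ p ∷ m ∷ Z)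
peak-insert {m} X p Z pk = record
  { bounded = All-insert X p Z (bounded pk) ≤-refl
  ; count   = trans (occurrences-insert m X p Z) (cong suc (count pk)) }

-- Running ψ

-- ψ(u) once u has had a reset: m resets so far, current bounce letter b, and r = |Maxa|
record Climbing (m b r : ℕ) (v : List ℕ) : Set where
  field
    peak      : Peak m b v
    maxaCount : length (maxaFor m v) ≡ r
    X         : List ℕ
    p j       : ℕ
    Z         : List ℕ
    shape     : v ≡ X ++ p ∷ m ∷ replicate j m ++ Z
    p+1≡m     : suc p ≡ m
    Z<m       : All (_< m) Z

open Climbing using (peak; maxaCount)

record Step (S : List ℕ → Set) (k : ℕ) (v : List ℕ) (a : ℕ) : Set where
  field
    area-step : area (ψstep v a) ≡ area v + k
    next      : S (ψstep v a)

open Step using (area-step; next)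

step-to : ∀ {S k v a v′} → ψstep v a ≡ v′ → area v′ ≡ area v + k → S v′ → Step S k v a
step-to refl Δ s = record { area-step = Δ ; next = s }

reset-step : ∀ {m b v a} → Peak m b v → a ≤ b → Step (Climbing (suc m) 0 a) (suc m) v a
reset-step {m} {v = v} {a} pk a≤b with maxbFor-index m v (subst (a <_) (sym (count pk)) (s≤s a≤b))
... | X , Z , refl , idx , occZ =
  step-to (ψstep-after X m Z refl (trans (index-admissible-maxb pk a≤b) idx)) (area-insert X m (suc m) Z)
  record
    { peak      = record
        { bounded = All-insert X m Z (All.map m≤n⇒m≤1+n (bounded pk)) ≤-refl
        ; count   = trans (occurrences-insert (suc m) X m Z)
                          (cong suc (occurrences-below (X ++ m ∷ Z) (All.map s≤s (bounded pk)))) }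
    ; maxaCount = trans (length-maxaFor-block (suc m) X m Z) (trans (length-maxaFor-below m Z Z<m+1) occZ)
    ; X = X ; p = m ; j = 0 ; Z = Z ; shape = refl ; p+1≡m = refl ; Z<m = Z<m+1 }
  where
  Z<m+1 : All (_< suc m) Z
  Z<m+1 = All.map s≤s (All.tail (++⁻ʳ X (bounded pk)))

climbMaxa-step : ∀ {m b r v d} → Climbing m b r v → d < r → Step (Climbing m (suc b) d) m v (suc b + d)
climbMaxa-step {m} {v = v} {d} st d<r with maxaFor-index m v (subst (d <_) (sym (maxaCount st)) d<r)
... | X , p , Z , refl , refl , Z<m , idx , lenZ =
  step-to (ψstep-after X p Z refl (trans (index-admissible-maxa (peak st) d<len) idx)) (area-insert X p (suc p) Z)
  record
    { peak = peak-insert X p Z (peak st) ; maxaCount = trans (length-maxaFor-block (suc p) X p Z) lenZ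
    ; X = X ; p = p ; j = 0 ; Z = Z ; shape = refl ; p+1≡m = refl ; Z<m = Z<m }
  where
  d<len : d < length (maxaFor (suc p) (X ++ p ∷ Z))
  d<len = subst (d <_) (sym (maxaCount st)) d<r

climbBlock-step : ∀ {m b r v} → Climbing m b r v → Step (Climbing m (suc b) r) m v (suc b + r)
climbBlock-step {b = b} record { peak = pk ; maxaCount = refl ; X = X ; p = p ; j = j ; Z = Z
                          ; shape = refl ; p+1≡m = refl ; Z<m = Z<m } =
  step-to (ψstep-after X p B refl idx) (area-insert X p m B)
  record
    { peak = peak-insert X p B pk
    ; maxaCount = trans (length-maxaFor-block m X p B)
                        (trans (length-maxaFor-peak m [] (replicate j m ++ Z))
                               (sym (length-maxaFor-block m X p (replicate j m ++ Z))))
    ; X = X ; p = p ; j = suc j ; Z = Z ; shape = refl ; p+1≡m = refl ; Z<m = Z<m }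
  where
  m = suc p
  B = m ∷ replicate j m ++ Z
  idx : index (admissible (X ++ p ∷ B)) (suc b + length (maxaFor m (X ++ p ∷ B))) ≡ suc (length X)
  idx = trans (index-admissible-i₀ pk)
              (cong (_∸ 1) (i₀-blockStartsFor (X ++ p ∷ B) (maxVal-peak pk)
                                              (blockStartsFor-last m false X p j Z refl Z<m)))

data Letter (b r : ℕ) : ℕ → Set where
  reset      : ∀ {a} → a ≤ b → Letter b r a
  climbMaxa  : ∀ {d} → d < r → Letter b r (suc b + d)
  climbBlock : Letter b r (suc b + r)

climb : ∀ {b r d} → d ≤ r → Letter b r (suc b + d)
climb d≤r with m≤n⇒m<n∨m≡n d≤r
... | inj₁ d<r  = climbMaxa d<r
... | inj₂ refl = climbBlock

letter : ∀ {b r a} → a ≤ suc (b + r) → Letter b r a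
letter {b} {r} {a} a≤ with a ≤? b
... | yes a≤b = reset a≤b
... | no  a≰b = subst (Letter b r) (m+[n∸m]≡n (≰⇒> a≰b))
                      (climb (subst (a ∸ suc b ≤_) (m+n∸m≡n (suc b) r) (∸-monoˡ-≤ (suc b) a≤)))

area-foldl-∷ : ∀ {S k v a s} xs → Step S k v a →
               area (foldl ψstep (ψstep v a) xs) ≡ area (ψstep v a) + s →
               area (foldl ψstep v (a ∷ xs)) ≡ area v + (k + s)
area-foldl-∷ {k = k} {v} {s = s} xs st rest =
  trans rest (trans (cong (_+ s) (area-step st)) (+-assoc (area v) k s))

-- the last letter read is b + r
area-foldl-climbing : ∀ {m b r v} xs → Climbing m b r v → Steps (b + r) xs →
           area (foldl ψstep v xs) ≡ area v + resetSum b m xs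
area-foldl-climbing          []       st _              = sym (+-identityʳ _)
area-foldl-climbing {b = b} {r} (a ∷ xs) st (a≤ , steps) with letter a≤
... | reset a≤b rewrite dec-false (suc b ≤? a) (≤⇒≯ a≤b) =
  area-foldl-∷ xs s (area-foldl-climbing xs (next s) steps)
  where s = reset-step (peak st) a≤b
... | climbMaxa {d} d<r rewrite dec-true (suc b ≤? suc b + d) (m≤m+n (suc b) d) =
  area-foldl-∷ xs s (area-foldl-climbing xs (next s) steps)
  where s = climbMaxa-step st d<r
... | climbBlock rewrite dec-true (suc b ≤? suc b + r) (m≤m+n (suc b) r) =
  area-foldl-∷ xs s (area-foldl-climbing xs (next s) steps)
  where s = climbBlock-step st

area-zeros : ∀ n → area (replicate n 0) ≡ 0
area-zeros zero    = refl
area-zeros (suc n) = area-zeros n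

zeros-peak : ∀ b → Peak 0 b (replicate (suc b) 0)
zeros-peak b = record { bounded = replicate⁺ (suc b) z≤n ; count = occurrences-replicate 0 (suc b) }

ψstep-zeros : ∀ b → ψstep (replicate (suc b) 0) (suc b) ≡ replicate (suc (suc b)) 0
ψstep-zeros b = cong (λ c → ins c v) (begin
  index (admissible v) (suc b)                         ≡⟨ cong (index (admissible v)) no-maxa ⟨
  index (admissible v) (suc b + length (maxaFor 0 v))  ≡⟨ index-admissible-i₀ pk ⟩
  i₀ v ∸ 1                                             ≡⟨ cong (_∸ 1) (i₀-blockStartsFor v (maxVal-peak pk) start) ⟩
  0                                                    ∎)
  where
  v = replicate (suc b) 0
  pk = zeros-peak b
  no-maxa : suc b + length (maxaFor 0 v) ≡ suc b
  no-maxa = trans (cong (λ k → suc b + k) (cong length (maxaFor-zero v))) (+-identityʳ (suc b))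
  start : last (blockStartsFor 0 false v) ≡ just 1
  start = cong (λ L → last (1 ∷ map suc L))
               (subst (λ w → blockStartsFor 0 true w ≡ []) (++-identityʳ (replicate b 0))
                      (blockStartsFor-inBlock 0 b [] []))

area-foldl-zeros : ∀ {b} xs → Steps b xs → area (foldl ψstep (replicate (suc b) 0) xs) ≡ resetSum b 0 xs
area-foldl-zeros {b} []       _            = area-zeros b
area-foldl-zeros {b} (a ∷ xs) (a≤ , steps) with a ≤? b
... | yes a≤b rewrite dec-false (suc b ≤? a) (≤⇒≯ a≤b) =
  trans (area-foldl-∷ xs s (area-foldl-climbing xs (next s) steps)) (cong (_+ suc (resetSum 0 1 xs)) (area-zeros b))
  where s = reset-step (zeros-peak b) a≤b
... | no a≰b with ≤-antisym a≤ (≰⇒> a≰b)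
...   | refl rewrite dec-true (suc b ≤? suc b) ≤-refl | ψstep-zeros b = area-foldl-zeros xs steps

corollary2p5 : (w : List ℕ) → IsAreaSeq w → bounce w ≡ area (ψ w)
corollary2p5 []       _            = refl
corollary2p5 (x ∷ xs) (refl , steps) = trans (bounce-resetSum 0 xs) (sym (area-foldl-zeros xs steps))
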